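{- Let $\mathbb{M}=(V,\mathcal{C})$ be a simple binary matroid, $\mathcal{D}$ its family of chordless circuits, and $h_{\mathbb{M}}=\Phi_{\mathcal{C}}$. Then $\mathcal{D}$ is the unique minimum-cardinality subfamily $\mathcal{D}'\subseteq\mathcal{C}$ with $\Phi_{\mathcal{D}'}=h_{\mathbb{M}}$. Furthermore, $\{(C\setminus\{v\})\to v: C\in\mathcal{D},\ v\in C\}$ is the unique minimum-cardinality set of circuit clauses whose conjunction equals $h_{\mathbb{M}}$.
   Context: A binary matroid is one representable over GF(2); simple means no loops and no parallel elements; $\mathcal{C}$ is the family of circuits. A circuit $C$ is chordless if there is no $C'\in\mathcal{C}$ with $|C'\setminus C|=1$ and $|C'|<|C|$. Boolean functions on $V$ are viewed as functions of subsets; the clause $B\to v$ ($v\notin B$) has true sets the $T$ with $B\not\subseteq T$ or $B\cup\{v\}\subseteq T$; $\Phi_{\mathcal{H}}=\bigwedge_{H\in\mathcal{H}}\bigwedge_{v\in H}((H\setminus\{v\})\to v)$. A circuit clause is a clause $(C\setminus\{v\})\to v$ with $C\in\mathcal{C}$, $v\in C$. -}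

module Defs where

open import Data.Nat using (ℕ; zero; suc)
open import Data.Bool using (Bool; true; false; if_then_else_; _xor_)
open import Data.Fin using (Fin; zero; suc)
open import Data.Vec using (Vec; []; _∷_; replicate; zipWith)
open import Data.Fin.Subset as S using (Subset; _∈_; _⊆_; _∪_; ⁅_⁆; _-_; _─_; ∣_∣; Nonempty)
open import Data.List using (List; length)
import Data.List.Membership.Propositional as L
open import Data.List.Relation.Unary.Unique.Propositional using (Unique)
open import Data.Product using (Σ; ∃; _×_; _,_)
open import Data.Sum using (_⊎_)
open import Relation.Nullary using (¬_)
open import Relation.Binary.PropositionalEquality using (_≡_; _≢_)
open import Function.Bundles using (_⇔_)

-- Binary matroids, given by a GF(2)-representation.
-- A matrix over GF(2) with m rows and columns indexed by the ground set
-- V = Fin n: column i is a vector in GF(2)^m (Bool with xor as +).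

Matrix : ℕ → ℕ → Set
Matrix m n = Fin n → Vec Bool m

colSum : ∀ {m n} → Matrix m n → Subset n → Vec Bool m
colSum {m} {zero}  A []      = replicate m false
colSum {m} {suc n} A (b ∷ S) =
  zipWith _xor_ (if b then A zero else replicate m false)
                (colSum (λ i → A (suc i)) S)

SumsToZero : ∀ {m n} → Matrix m n → Subset n → Set
SumsToZero {m} A S = Nonempty S × colSum A S ≡ replicate m false

-- Circuits of the binary matroid M[A]: minimal nonempty subsets whose
-- columns sum to zero over GF(2) (= minimal dependent sets).
IsCircuit : ∀ {m n} → Matrix m n → Subset n → Set
IsCircuit A C = SumsToZero A C × (∀ D → D ⊆ C → SumsToZero A D → D ≡ C)

Simple : ∀ {m n} → Matrix m n → Set
Simple A = ∀ C → IsCircuit A C → (∣ C ∣ ≢ 1) × (∣ C ∣ ≢ 2)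

IsChordless : ∀ {m n} → Matrix m n → Subset n → Set
IsChordless A C = IsCircuit A C ×
  ¬ (Σ (Subset _) λ C' → IsCircuit A C' × (∣ C' ─ C ∣ ≡ 1) × (∣ C' ∣ Data.Nat.< ∣ C ∣))

-- Boolean functions on V = Fin n, as predicates on subsets T ⊆ V.

BoolFun : ℕ → Set₁
BoolFun n = Subset n → Set

_≐_ : ∀ {n} → BoolFun n → BoolFun n → Set
f ≐ g = ∀ T → f T ⇔ g T

Clause : ∀ {n} → Subset n → Fin n → BoolFun n
Clause B v T = (¬ (B ⊆ T)) ⊎ ((B ∪ ⁅ v ⁆) ⊆ T)

Φ : ∀ {n} → (Subset n → Set) → BoolFun n
Φ H T = ∀ X → H X → ∀ v → v ∈ X → Clause (X - v) v T

-- A finite family of subsets given as a duplicate-free list.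
FamOf : ∀ {n} → List (Subset n) → Subset n → Set
FamOf Ds X = X L.∈ Ds

hM : ∀ {m n} → Matrix m n → BoolFun n
hM A = Φ (IsCircuit A)

-- Clauses as syntactic objects (B , v) meaning B → v.

ClauseSyn : ℕ → Set
ClauseSyn n = Subset n × Fin n

IsCircuitClause : ∀ {m n} → Matrix m n → ClauseSyn n → Set
IsCircuitClause A (B , v) = Σ (Subset _) λ C → IsCircuit A C × v ∈ C × B ≡ C - v

Conj : ∀ {n} → List (ClauseSyn n) → BoolFun n
Conj Ks T = ∀ B v → (B , v) L.∈ Ks → Clause B v T

-- If a circuit C has a chord C′ (a smaller circuit with C′ ─ C = {w}), then over
-- GF(2) the set C ⊕ C′ sums to zero and so is covered by circuits, all smaller than
-- C because C′ shares at least two elements with C (simplicity gives |C′| ≥ 3).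
-- Whenever C - v ⊆ T, the clauses of C′ and of these circuits force both w and v
-- into T; by induction on |C| the chordless clauses thus imply h_M.
-- Conversely, for C chordless and v ∈ C, the set C - v violates (C - v) → v but
-- satisfies every other circuit clause: a circuit C′ ≠ C firing there would lie in
-- C, be a chord of C, or satisfy C′ - w = C - v, and then C ⊕ C′ ⊆ {v, w} would hold
-- a circuit of size at most 2.  So every representing family of circuits (of
-- circuit clauses) contains all chordless ones, and minimality follows by counting.
{-# OPTIONS --safe #-}
module Submission where

open import Defs
open import Data.Bool using (Bool; true; false; _xor_; if_then_else_)
open import Data.Bool.Properties
  using (xor-assoc; xor-comm; xor-identityˡ; xor-identityʳ; xor-same)
  renaming (_≟_ to _≟ᴮ_)
open import Data.Empty using (⊥; ⊥-elim)
open import Data.Fin using (Fin; zero; suc)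
open import Data.Fin.Properties using (any?) renaming (_≟_ to _≟ᶠ_)
open import Data.Fin.Subset
  using (Subset; _∈_; _∉_; _⊆_; _⊂_; _-_; _─_; ⁅_⁆; ∣_∣; Nonempty)
open import Data.Fin.Subset.Properties
  using ( _∈?_; _⊆?_; nonempty?; anySubset?; Empty-unique; ∣⊥∣≡0; x∈⁅x⁆; ∣⁅x⁆∣≡1
        ; x∈⁅y⁆⇒x≡y; x∈p∪q⁻; x∈p∪q⁺; ⊆-antisym; ⊆-reflexive; ⊂-irref; p⊆q⇒∣p∣≤∣q∣
        ; p⊂q⇒p⊆q; p⊂q⇒∣p∣<∣q∣; p─q⊆p; p─⊥≡p; x∈p∧x∉q⇒x∈p─q; x∈p∧x≢y⇒x∈p-y
        ; x∈p⇒∣p-x∣<∣p∣ )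
open import Data.List using (List; []; _∷_; length; _++_)
open import Data.List.Properties using (length-++)
open import Data.List.Membership.Propositional using () renaming (_∈_ to _∈ᴸ_)
open import Data.List.Membership.Propositional.Properties using (∈-∃++; ∈-++⁻; ∈-++⁺ˡ; ∈-++⁺ʳ)
import Data.List.Membership.DecPropositional as DecMembership
open import Data.List.Relation.Binary.Subset.Propositional renaming (_⊆_ to _⊆ᴸ_)
open import Data.List.Relation.Unary.All as All using (All)
open import Data.List.Relation.Unary.AllPairs using (_∷_)
open import Data.List.Relation.Unary.Any using (here; there)
open import Data.List.Relation.Unary.Unique.Propositional using (Unique)
open import Data.List.Relation.Unary.Unique.Propositional.Properties using (Unique[x∷xs]⇒x∉xs)
open import Data.Nat using (ℕ; zero; suc; _+_; _≤_; _<_; z≤n; s≤s; _<?_)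
open import Data.Nat.Induction using (<-wellFounded)
open import Data.Nat.Properties
  using (≤-trans; ≤-reflexive; ≤-<-trans; <-≤-trans; <-irrefl; +-suc; ≤-pred; n≤1+n; module ≤-Reasoning)
  renaming (_≟_ to _≟ℕ_)
open import Data.Product using (Σ; ∃; _×_; _,_; proj₁; proj₂)
import Data.Product.Properties as Product
open import Data.Sum using (_⊎_; inj₁; inj₂)
open import Data.Vec using (Vec; []; _∷_; replicate; zipWith; here; there)
import Data.Vec.Properties as Vec
open import Function using (_∘_; _on_)
open import Function.Bundles using (_⇔_; mk⇔; Equivalence)
import Function.Properties.Equivalence as ⇔
open import Induction.WellFounded using (WellFounded; Acc; acc)
import Relation.Binary.Construct.On as On
open import Relation.Binary.Definitions using (DecidableEquality)
open import Relation.Binary.PropositionalEquality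
open import Relation.Nullary using (¬_; Dec; yes; no; contradiction)
open import Relation.Nullary.Decidable using (_×-dec_; ¬?; decidable-stable)

open Equivalence using (to; from)

private variable
  m n : ℕ

-- GF(2)-vectors

infixl 6 _⊕_

-- On Subset n = Vec Bool n this is the symmetric difference.
_⊕_ : Vec Bool m → Vec Bool m → Vec Bool m
_⊕_ = zipWith _xor_

0ᵛ : ∀ m → Vec Bool m
0ᵛ m = replicate m false

⊕-assoc : (a b c : Vec Bool m) → (a ⊕ b) ⊕ c ≡ a ⊕ (b ⊕ c)
⊕-assoc = Vec.zipWith-assoc xor-assoc

⊕-comm : (a b : Vec Bool m) → a ⊕ b ≡ b ⊕ a
⊕-comm = Vec.zipWith-comm xor-comm

⊕-identityˡ : (a : Vec Bool m) → 0ᵛ m ⊕ a ≡ a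
⊕-identityˡ = Vec.zipWith-identityˡ xor-identityˡ

⊕-identityʳ : (a : Vec Bool m) → a ⊕ 0ᵛ m ≡ a
⊕-identityʳ = Vec.zipWith-identityʳ xor-identityʳ

⊕-self : (a : Vec Bool m) → a ⊕ a ≡ 0ᵛ m
⊕-self []      = refl
⊕-self (x ∷ a) = cong₂ _∷_ (xor-same x) (⊕-self a)

⊕-interchange : (a b c d : Vec Bool m) → (a ⊕ b) ⊕ (c ⊕ d) ≡ (a ⊕ c) ⊕ (b ⊕ d)
⊕-interchange a b c d = begin
  (a ⊕ b) ⊕ (c ⊕ d)  ≡⟨ ⊕-assoc a b (c ⊕ d) ⟩
  a ⊕ (b ⊕ (c ⊕ d))  ≡⟨ cong (a ⊕_) (⊕-assoc b c d) ⟨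
  a ⊕ ((b ⊕ c) ⊕ d)  ≡⟨ cong (λ x → a ⊕ (x ⊕ d)) (⊕-comm b c) ⟩
  a ⊕ ((c ⊕ b) ⊕ d)  ≡⟨ cong (a ⊕_) (⊕-assoc c b d) ⟩
  a ⊕ (c ⊕ (b ⊕ d))  ≡⟨ ⊕-assoc a c (b ⊕ d) ⟨
  (a ⊕ c) ⊕ (b ⊕ d)  ∎
  where open ≡-Reasoning

if-xor : (a : Vec Bool m) (b c : Bool) →
  (if b xor c then a else 0ᵛ m) ≡ (if b then a else 0ᵛ m) ⊕ (if c then a else 0ᵛ m)
if-xor a     true  true  = sym (⊕-self a)
if-xor a     true  false = sym (⊕-identityʳ a)
if-xor a     false true  = sym (⊕-identityˡ a)
if-xor {m} a false false = sym (⊕-self (0ᵛ m))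

colSum-⊕ : (A : Matrix m n) (S T : Subset n) → colSum A (S ⊕ T) ≡ colSum A S ⊕ colSum A T
colSum-⊕ {m} {zero}  A []      []      = sym (⊕-self (0ᵛ m))
colSum-⊕ {m} {suc n} A (b ∷ S) (c ∷ T) =
  trans (cong₂ _⊕_ (if-xor (A zero) b c) (colSum-⊕ (A ∘ suc) S T))
        (⊕-interchange _ _ _ _)

-- Subsets

_≟ˢ_ : DecidableEquality (Subset n)
_≟ˢ_ = Vec.≡-dec _≟ᴮ_

x∈p⊕q⁻ : ∀ {x : Fin n} p q → x ∈ p ⊕ q → (x ∈ p × x ∉ q) ⊎ (x ∉ p × x ∈ q)
x∈p⊕q⁻ (true  ∷ p) (false ∷ q) here = inj₁ (here , λ ())
x∈p⊕q⁻ (false ∷ p) (true  ∷ q) here = inj₂ ((λ ()) , here)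
x∈p⊕q⁻ (_ ∷ p) (_ ∷ q) (there x∈) with x∈p⊕q⁻ p q x∈
... | inj₁ (x∈p , x∉q) = inj₁ (there x∈p , λ { (there x∈q) → x∉q x∈q })
... | inj₂ (x∉p , x∈q) = inj₂ ((λ { (there x∈p) → x∉p x∈p }) , there x∈q)

x∈p⊕q⁺ : ∀ {x : Fin n} {p q} → (x ∈ p × x ∉ q) ⊎ (x ∉ p × x ∈ q) → x ∈ p ⊕ q
x∈p⊕q⁺ {q = true  ∷ q} (inj₁ (here , x∉q)) = contradiction here x∉q
x∈p⊕q⁺ {q = false ∷ q} (inj₁ (here , _))   = here
x∈p⊕q⁺ {p = true  ∷ p} (inj₂ (x∉p , here)) = contradiction here x∉p
x∈p⊕q⁺ {p = false ∷ p} (inj₂ (_ , here))   = here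
x∈p⊕q⁺ {p = _ ∷ p} {_ ∷ q} (inj₁ (there x∈p , x∉q)) =
  there (x∈p⊕q⁺ (inj₁ (x∈p , x∉q ∘ there)))
x∈p⊕q⁺ {p = _ ∷ p} {_ ∷ q} (inj₂ (x∉p , there x∈q)) =
  there (x∈p⊕q⁺ (inj₂ (x∉p ∘ there , x∈q)))

p⊕q⊂p : ∀ {p q : Subset n} → q ⊆ p → Nonempty q → p ⊕ q ⊂ p
p⊕q⊂p {p = p} {q} q⊆p (x , x∈q) = p⊕q⊆p , x , q⊆p x∈q , x∉p⊕q
  where
  p⊕q⊆p : p ⊕ q ⊆ p
  p⊕q⊆p y∈ with x∈p⊕q⁻ p q y∈
  ... | inj₁ (y∈p , _)   = y∈p
  ... | inj₂ (y∉p , y∈q) = contradiction (q⊆p y∈q) y∉p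
  x∉p⊕q : x ∉ p ⊕ q
  x∉p⊕q x∈ with x∈p⊕q⁻ p q x∈
  ... | inj₁ (_ , x∉q) = x∉q x∈q
  ... | inj₂ (x∉p , _) = x∉p (q⊆p x∈q)

x∈p─q⇒x∉q : ∀ {x : Fin n} p q → x ∈ p ─ q → x ∉ q
x∈p─q⇒x∉q (_ ∷ p) (true  ∷ q) ()         here
x∈p─q⇒x∉q (_ ∷ p) (false ∷ q) here       ()
x∈p─q⇒x∉q (_ ∷ p) (_     ∷ q) (there x∈) (there x∈q) = x∈p─q⇒x∉q p q x∈ x∈q

x∈p-y⇒x∈p : ∀ {x y : Fin n} {p} → x ∈ p - y → x ∈ p
x∈p-y⇒x∈p {y = y} {p} = p─q⊆p p ⁅ y ⁆

x∈p-y⇒x≢y : ∀ {x y : Fin n} {p} → x ∈ p - y → x ≢ y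
x∈p-y⇒x≢y {x = x} {p = p} x∈ refl = x∈p─q⇒x∉q p ⁅ x ⁆ x∈ (x∈⁅x⁆ x)

p-x⊆q⇒p⊆q : ∀ {x} {p q : Subset n} → p - x ⊆ q → x ∈ q → p ⊆ q
p-x⊆q⇒p⊆q {x = x} p-x⊆q x∈q {y} y∈p with y ≟ᶠ x
... | yes refl = x∈q
... | no y≢x   = p-x⊆q (x∈p∧x≢y⇒x∈p-y y∈p y≢x)

[p-x,x]≡[q-y,y]⇒p≡q : ∀ {x y} {p q : Subset n} → x ∈ p → y ∈ q →
  (p - x , x) ≡ (q - y , y) → p ≡ q
[p-x,x]≡[q-y,y]⇒p≡q x∈p y∈q eq with Product.,-injective eq
... | p-x≡q-x , refl = ⊆-antisym
  (p-x⊆q⇒p⊆q (x∈p-y⇒x∈p ∘ ⊆-reflexive p-x≡q-x) y∈q)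
  (p-x⊆q⇒p⊆q (x∈p-y⇒x∈p ∘ ⊆-reflexive (sym p-x≡q-x)) x∈p)

⊆∧≢⇒⊂ : ∀ {p q : Subset n} → p ⊆ q → p ≢ q → p ⊂ q
⊆∧≢⇒⊂ {p = p} {q} p⊆q p≢q with any? (λ y → (y ∈? q) ×-dec ¬? (y ∈? p))
... | yes witness = p⊆q , witness
... | no ¬witness = contradiction (⊆-antisym p⊆q q⊆p) p≢q
  where
  q⊆p : q ⊆ p
  q⊆p {y} y∈q = decidable-stable (y ∈? p) λ y∉p → ¬witness (y , y∈q , y∉p)

∣p∣≤1+∣p-x∣ : ∀ (p : Subset n) x → ∣ p ∣ ≤ suc ∣ p - x ∣
∣p∣≤1+∣p-x∣ (true  ∷ p) zero    = s≤s (≤-reflexive (cong ∣_∣ (sym (p─⊥≡p p))))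
∣p∣≤1+∣p-x∣ (false ∷ p) zero    = ≤-trans (≤-reflexive (cong ∣_∣ (sym (p─⊥≡p p)))) (n≤1+n _)
∣p∣≤1+∣p-x∣ (true  ∷ p) (suc x) = s≤s (∣p∣≤1+∣p-x∣ p x)
∣p∣≤1+∣p-x∣ (false ∷ p) (suc x) = ∣p∣≤1+∣p-x∣ p x

x∈p⇒0<∣p∣ : ∀ {x} {p : Subset n} → x ∈ p → 0 < ∣ p ∣
x∈p⇒0<∣p∣ x∈p = ≤-<-trans z≤n (x∈p⇒∣p-x∣<∣p∣ x∈p)

0<∣p∣⇒Nonempty : ∀ (p : Subset n) → 0 < ∣ p ∣ → Nonempty p
0<∣p∣⇒Nonempty {n} p 0<∣p∣ with nonempty? p
... | yes ne  = ne
... | no ¬ne = contradiction (subst (0 <_) (trans (cong ∣_∣ (Empty-unique ¬ne)) (∣⊥∣≡0 n)) 0<∣p∣) (<-irrefl refl)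

1<∣p∣⇒two-members : ∀ (p : Subset n) → 1 < ∣ p ∣ → ∃ λ a → ∃ λ b → a ∈ p × b ∈ p - a
1<∣p∣⇒two-members p 1<∣p∣ with 0<∣p∣⇒Nonempty p (≤-trans (s≤s z≤n) 1<∣p∣)
... | a , a∈p with 0<∣p∣⇒Nonempty (p - a) (≤-pred (≤-trans 1<∣p∣ (∣p∣≤1+∣p-x∣ p a)))
...   | b , b∈p-a = a , b , a∈p , b∈p-a

∣p─q∣≡1⇒single-outsider : ∀ (p q : Subset n) → ∣ p ─ q ∣ ≡ 1 →
  ∃ λ w → w ∈ p × w ∉ q × p - w ⊆ q
∣p─q∣≡1⇒single-outsider p q ∣p─q∣≡1 with 0<∣p∣⇒Nonempty (p ─ q) (≤-reflexive (sym ∣p─q∣≡1))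
... | w , w∈p─q = w , p─q⊆p p q w∈p─q , x∈p─q⇒x∉q p q w∈p─q , p-w⊆q
  where
  p-w⊆q : p - w ⊆ q
  p-w⊆q {y} y∈p-w = decidable-stable (y ∈? q) λ y∉q →
    let y∈[p─q]-w = x∈p∧x≢y⇒x∈p-y (x∈p∧x∉q⇒x∈p─q (x∈p-y⇒x∈p y∈p-w) y∉q) (x∈p-y⇒x≢y y∈p-w)
    in contradiction (subst (2 ≤_) ∣p─q∣≡1
         (≤-trans (s≤s (x∈p⇒0<∣p∣ y∈[p─q]-w)) (x∈p⇒∣p-x∣<∣p∣ w∈p─q))) λ { (s≤s ()) }

single-outsider⇒∣p─q∣≡1 : ∀ {w} {p q : Subset n} → w ∈ p → w ∉ q → p - w ⊆ q → ∣ p ─ q ∣ ≡ 1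
single-outsider⇒∣p─q∣≡1 {w = w} {p} {q} w∈p w∉q p-w⊆q =
  trans (cong ∣_∣ (⊆-antisym p─q⊆⁅w⁆ ⁅w⁆⊆p─q)) (∣⁅x⁆∣≡1 w)
  where
  p─q⊆⁅w⁆ : p ─ q ⊆ ⁅ w ⁆
  p─q⊆⁅w⁆ {y} y∈ with y ≟ᶠ w
  ... | yes refl = x∈⁅x⁆ w
  ... | no y≢w   = contradiction (p-w⊆q (x∈p∧x≢y⇒x∈p-y (p─q⊆p p q y∈) y≢w)) (x∈p─q⇒x∉q p q y∈)
  ⁅w⁆⊆p─q : ⁅ w ⁆ ⊆ p ─ q
  ⁅w⁆⊆p─q {y} y∈ rewrite x∈⁅y⁆⇒x≡y w y∈ = x∈p∧x∉q⇒x∈p─q w∈p w∉q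

card-wellFounded : WellFounded {A = Subset n} (_<_ on ∣_∣)
card-wellFounded = On.wellFounded ∣_∣ <-wellFounded

-- Clauses and the functions Φ

Clause⇒implication : ∀ {B T : Subset n} {v} → Clause B v T → B ⊆ T → v ∈ T
Clause⇒implication (inj₁ B⊈T)  B⊆T = contradiction (λ {x} → B⊆T {x}) B⊈T
Clause⇒implication {v = v} (inj₂ B∪v⊆T) _ = B∪v⊆T (x∈p∪q⁺ (inj₂ (x∈⁅x⁆ v)))

implication⇒Clause : ∀ {B T : Subset n} {v} → (B ⊆ T → v ∈ T) → Clause B v T
implication⇒Clause {B = B} {T} {v} B⊆T⇒v∈T with B ⊆? T
... | no B⊈T  = inj₁ B⊈T
... | yes B⊆T = inj₂ λ {y} y∈ → B∪v⊆T (x∈p∪q⁻ B ⁅ v ⁆ y∈)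
  where
  B∪v⊆T : ∀ {y} → y ∈ B ⊎ y ∈ ⁅ v ⁆ → y ∈ T
  B∪v⊆T (inj₁ y∈B) = B⊆T y∈B
  B∪v⊆T (inj₂ y∈v) rewrite x∈⁅y⁆⇒x≡y v y∈v = B⊆T⇒v∈T B⊆T

_≟ᴷ_ : DecidableEquality (ClauseSyn n)
_≟ᴷ_ = Product.≡-dec _≟ˢ_ _≟ᶠ_

Clause-fails-at-premise : ∀ {X : Subset n} {v} → ¬ Clause (X - v) v (X - v)
Clause-fails-at-premise cl = x∈p-y⇒x≢y (Clause⇒implication cl (λ x∈ → x∈)) refl

≐-trans : {f g h : BoolFun n} → f ≐ g → g ≐ h → f ≐ h
≐-trans f≐g g≐h T = ⇔.trans (f≐g T) (g≐h T)

Φ-cong : {H H′ : Subset n → Set} → (∀ X → H X ⇔ H′ X) → Φ H ≐ Φ H′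
Φ-cong H⇔H′ T = mk⇔ (λ φ X h′ → φ X (from (H⇔H′ X) h′)) (λ φ X h → φ X (to (H⇔H′ X) h))

Conj≐Φ : {H : Subset n → Set} {Ks : List (ClauseSyn n)} →
  (∀ B v → (B , v) ∈ᴸ Ks ⇔ Σ (Subset n) (λ X → H X × v ∈ X × B ≡ X - v)) → Conj Ks ≐ Φ H
Conj≐Φ Ks⇔ T = mk⇔
  (λ κ X h v v∈X → κ (X - v) v (from (Ks⇔ (X - v) v) (X , h , v∈X , refl)))
  λ φ B v K∈ → member-clause (to (Ks⇔ B v) K∈) φ
  where
  member-clause : ∀ {H B v} → Σ _ (λ X → H X × v ∈ X × B ≡ X - v) → Φ H T → Clause B v T
  member-clause (X , h , v∈X , refl) φ = φ X h _ v∈X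

-- Counting duplicate-free lists

module _ {a} {X : Set a} where

  Unique∧⊆⇒length≤ : ∀ {xs ys : List X} → Unique xs → xs ⊆ᴸ ys → length xs ≤ length ys
  Unique∧⊆⇒length≤ {[]}     _              _        = z≤n
  Unique∧⊆⇒length≤ {x ∷ xs} Unique[x∷xs]@(_ ∷ Unique[xs]) x∷xs⊆ys
    with ∈-∃++ (x∷xs⊆ys (here refl))
  ... | us , vs , refl = begin
    suc (length xs)           ≤⟨ s≤s (Unique∧⊆⇒length≤ Unique[xs] xs⊆us++vs) ⟩
    suc (length (us ++ vs))   ≡⟨ cong suc (length-++ us) ⟩
    suc (length us + length vs) ≡⟨ +-suc (length us) (length vs) ⟨
    length us + length (x ∷ vs) ≡⟨ length-++ us ⟨
    length (us ++ x ∷ vs)     ∎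
    where
    open ≤-Reasoning
    xs⊆us++vs : xs ⊆ᴸ us ++ vs
    xs⊆us++vs {z} z∈xs with ∈-++⁻ us (x∷xs⊆ys (there z∈xs))
    ... | inj₁ z∈us         = ∈-++⁺ˡ z∈us
    ... | inj₂ (here refl)  = contradiction z∈xs (Unique[x∷xs]⇒x∉xs Unique[x∷xs])
    ... | inj₂ (there z∈vs) = ∈-++⁺ʳ us z∈vs

  Unique∧⊆⇒minimal : DecidableEquality X → ∀ {xs ys : List X} → Unique xs → xs ⊆ᴸ ys →
    (length xs ≤ length ys) × (length ys ≡ length xs → ∀ z → z ∈ᴸ ys ⇔ z ∈ᴸ xs)
  Unique∧⊆⇒minimal _≟_ {xs} {ys} Unique[xs] xs⊆ys =
    Unique∧⊆⇒length≤ Unique[xs] xs⊆ys , λ same-length z → mk⇔ (ys⊆xs same-length) xs⊆ys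
    where
    open DecMembership _≟_ using () renaming (_∈?_ to _∈ᴸ?_)
    ys⊆xs : length ys ≡ length xs → ys ⊆ᴸ xs
    ys⊆xs same-length {z} z∈ys = decidable-stable (z ∈ᴸ? xs) λ z∉xs →
      <-irrefl refl (subst (length xs <_) same-length
        (Unique∧⊆⇒length≤ (Unique-∷ z∉xs) (∈∧⊆⇒∷⊆ z∈ys)))
      where
      Unique-∷ : ¬ z ∈ᴸ xs → Unique (z ∷ xs)
      Unique-∷ z∉xs = All.tabulate (λ y∈xs z≡y → z∉xs (subst (_∈ᴸ xs) (sym z≡y) y∈xs)) ∷ Unique[xs]
      ∈∧⊆⇒∷⊆ : z ∈ᴸ ys → z ∷ xs ⊆ᴸ ys
      ∈∧⊆⇒∷⊆ z∈ys (here refl)  = z∈ys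
      ∈∧⊆⇒∷⊆ _    (there y∈xs) = xs⊆ys y∈xs

-- Circuits of a binary matroid

module _ (A : Matrix m n) where

  SumsToZero? : ∀ S → Dec (SumsToZero A S)
  SumsToZero? S = nonempty? S ×-dec Vec.≡-dec _≟ᴮ_ (colSum A S) (0ᵛ m)

  ⊕-zeroSum : ∀ {S T} → colSum A S ≡ 0ᵛ m → colSum A T ≡ 0ᵛ m → colSum A (S ⊕ T) ≡ 0ᵛ m
  ⊕-zeroSum {S} {T} zS zT = begin
    colSum A (S ⊕ T)         ≡⟨ colSum-⊕ A S T ⟩
    colSum A S ⊕ colSum A T  ≡⟨ cong₂ _⊕_ zS zT ⟩
    0ᵛ m ⊕ 0ᵛ m              ≡⟨ ⊕-self (0ᵛ m) ⟩
    0ᵛ m                     ∎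
    where open ≡-Reasoning

  circuit-or-smaller : ∀ {S} → SumsToZero A S →
    IsCircuit A S ⊎ Σ (Subset n) (λ D → D ⊂ S × SumsToZero A D)
  circuit-or-smaller {S} zS
    with anySubset? (λ D → (D ⊆? S) ×-dec (SumsToZero? D ×-dec ¬? (D ≟ˢ S)))
  ... | yes (D , D⊆S , zD , D≢S) = inj₂ (D , ⊆∧≢⇒⊂ D⊆S D≢S , zD)
  ... | no none = inj₁ (zS , λ D D⊆S zD → decidable-stable (D ≟ˢ S) λ D≢S → none (D , D⊆S , zD , D≢S))

  IsCircuit? : ∀ C → Dec (IsCircuit A C)
  IsCircuit? C with SumsToZero? C
  ... | no ¬zC = no (¬zC ∘ proj₁)
  ... | yes zC with circuit-or-smaller zC
  ...   | inj₁ cC             = yes cC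
  ...   | inj₂ (D , D⊂C , zD) = no λ cC → ⊂-irref (proj₂ cC D (p⊂q⇒p⊆q D⊂C) zD) D⊂C

  IsChordlessClause : ClauseSyn n → Set
  IsChordlessClause (B , v) = Σ (Subset n) λ C → IsChordless A C × v ∈ C × B ≡ C - v

  Chord : Subset n → Subset n → Set
  Chord C C′ = IsCircuit A C′ × (∣ C′ ─ C ∣ ≡ 1) × (∣ C′ ∣ < ∣ C ∣)

  HasChord? : ∀ C → Dec (Σ (Subset n) (Chord C))
  HasChord? C = anySubset? λ C′ → IsCircuit? C′ ×-dec ((∣ C′ ─ C ∣ ≟ℕ 1) ×-dec (∣ C′ ∣ <? ∣ C ∣))

  CircuitThrough : Fin n → Subset n → Set
  CircuitThrough x S = Σ (Subset n) λ C → IsCircuit A C × C ⊆ S × x ∈ C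

  CircuitThrough-mono : ∀ {x U S} → U ⊆ S → CircuitThrough x U → CircuitThrough x S
  CircuitThrough-mono U⊆S (C , cC , C⊆U , x∈C) = C , cC , U⊆S ∘ C⊆U , x∈C

  -- Over GF(2), a zero-sum set is a disjoint union of circuits.
  circuit-through : ∀ {x} S → Acc (_<_ on ∣_∣) S → colSum A S ≡ 0ᵛ m → x ∈ S →
    CircuitThrough x S
  circuit-through {x} S (acc smaller) zS x∈S with circuit-or-smaller ((x , x∈S) , zS)
  ... | inj₁ cS = S , cS , (λ y∈ → y∈) , x∈S
  ... | inj₂ (D , D⊂S , D≠∅ , zD) with x ∈? D
  ...   | yes x∈D = CircuitThrough-mono (p⊂q⇒p⊆q D⊂S) (circuit-through D (smaller (p⊂q⇒∣p∣<∣q∣ D⊂S)) zD x∈D)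
  ...   | no x∉D  = CircuitThrough-mono (p⊂q⇒p⊆q S⊕D⊂S)
                      (circuit-through (S ⊕ D) (smaller (p⊂q⇒∣p∣<∣q∣ S⊕D⊂S)) (⊕-zeroSum zS zD)
                        (x∈p⊕q⁺ (inj₁ (x∈S , x∉D))))
    where
    S⊕D⊂S : S ⊕ D ⊂ S
    S⊕D⊂S = p⊕q⊂p (p⊂q⇒p⊆q D⊂S) D≠∅

  zeroSum⇒circuit-through : ∀ {x S} → colSum A S ≡ 0ᵛ m → x ∈ S → CircuitThrough x S
  zeroSum⇒circuit-through {S = S} = circuit-through S (card-wellFounded S)

  module _ (simple : Simple A) where

    3≤∣circuit∣ : ∀ {C} → IsCircuit A C → 3 ≤ ∣ C ∣
    3≤∣circuit∣ {C} cC with ∣ C ∣ | x∈p⇒0<∣p∣ (proj₂ (proj₁ (proj₁ cC))) | simple C cC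
    ... | suc zero          | _ | ≢1 , _ = contradiction refl ≢1
    ... | suc (suc zero)    | _ | _ , ≢2 = contradiction refl ≢2
    ... | suc (suc (suc _)) | _ | _      = s≤s (s≤s (s≤s z≤n))

    no-twin-circuits : ∀ {C C′ v w} → IsCircuit A C → IsCircuit A C′ → v ∈ C → v ∉ C′ →
      C - v ≡ C′ - w → ⊥
    no-twin-circuits {C} {C′} {v} {w} cC cC′ v∈C v∉C′ C-v≡C′-w
      with zeroSum⇒circuit-through (⊕-zeroSum (proj₂ (proj₁ cC)) (proj₂ (proj₁ cC′)))
             (x∈p⊕q⁺ (inj₁ (v∈C , v∉C′)))
    ... | D , cD , D⊆C⊕C′ , v∈D =
      contradiction (≤-trans (3≤∣circuit∣ cD) ∣D∣≤2) λ { (s≤s (s≤s ())) }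
      where
      D-v⊆⁅w⁆ : D - v ⊆ ⁅ w ⁆
      D-v⊆⁅w⁆ {y} y∈D-v with x∈p⊕q⁻ C C′ (D⊆C⊕C′ (x∈p-y⇒x∈p y∈D-v))
      ... | inj₁ (y∈C , y∉C′) =
        contradiction (x∈p-y⇒x∈p (subst (y ∈_) C-v≡C′-w (x∈p∧x≢y⇒x∈p-y y∈C (x∈p-y⇒x≢y y∈D-v)))) y∉C′
      ... | inj₂ (y∉C , y∈C′) with y ≟ᶠ w
      ...   | yes refl = x∈⁅x⁆ w
      ...   | no y≢w   =
        contradiction (x∈p-y⇒x∈p (subst (y ∈_) (sym C-v≡C′-w) (x∈p∧x≢y⇒x∈p-y y∈C′ y≢w))) y∉C
      ∣D∣≤2 : ∣ D ∣ ≤ 2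
      ∣D∣≤2 = ≤-trans (∣p∣≤1+∣p-x∣ D v) (s≤s (≤-trans (p⊆q⇒∣p∣≤∣q∣ D-v⊆⁅w⁆) (≤-reflexive (∣⁅x⁆∣≡1 w))))

    chordless⇒C-v-closed-under-circuit : ∀ {C C′ v w} → IsChordless A C → v ∈ C → IsCircuit A C′ → C′ ≢ C →
      w ∈ C′ → C′ - w ⊆ C - v → w ∈ C - v
    chordless⇒C-v-closed-under-circuit {C} {C′} {v} {w} (cC , no-chord) v∈C cC′ C′≢C w∈C′ C′-w⊆C-v
      with w ∈? (C - v)
    ... | yes w∈C-v = w∈C-v
    ... | no w∉C-v with w ≟ᶠ v
    ...   | yes refl = contradiction (proj₂ cC C′ (p-x⊆q⇒p⊆q (x∈p-y⇒x∈p ∘ C′-w⊆C-v) v∈C) (proj₁ cC′)) C′≢C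
    ...   | no w≢v   = ⊥-elim (no-twin-circuits cC cC′ v∈C v∉C′ (sym C′-w≡C-v))
      where
      w∉C : w ∉ C
      w∉C w∈C = w∉C-v (x∈p∧x≢y⇒x∈p-y w∈C w≢v)
      ∣C′∣≮∣C∣ : ¬ ∣ C′ ∣ < ∣ C ∣
      ∣C′∣≮∣C∣ C′<C = no-chord (C′ , cC′ , single-outsider⇒∣p─q∣≡1 w∈C′ w∉C (x∈p-y⇒x∈p ∘ C′-w⊆C-v) , C′<C)
      C′-w≡C-v : C′ - w ≡ C - v
      C′-w≡C-v = decidable-stable ((C′ - w) ≟ˢ (C - v)) λ C′-w≢C-v → ∣C′∣≮∣C∣
        (≤-<-trans (∣p∣≤1+∣p-x∣ C′ w)
          (<-≤-trans (s≤s (p⊂q⇒∣p∣<∣q∣ (⊆∧≢⇒⊂ C′-w⊆C-v C′-w≢C-v))) (x∈p⇒∣p-x∣<∣p∣ v∈C)))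
      v∉C′ : v ∉ C′
      v∉C′ v∈C′ = x∈p-y⇒x≢y (subst (v ∈_) C′-w≡C-v (x∈p∧x≢y⇒x∈p-y v∈C′ (w≢v ∘ sym))) refl

    chordless⇒C-v-closed-under-other-clauses : ∀ {C v B w} → IsChordless A C → v ∈ C →
      IsCircuitClause A (B , w) → (B , w) ≢ (C - v , v) → B ⊆ C - v → w ∈ C - v
    chordless⇒C-v-closed-under-other-clauses {C} {v} {w = w} chordless v∈C (C′ , cC′ , w∈C′ , refl) K≢
      with C′ ≟ˢ C
    ... | no C′≢C = chordless⇒C-v-closed-under-circuit chordless v∈C cC′ C′≢C w∈C′
    ... | yes refl with w ≟ᶠ v
    ...   | yes refl = contradiction refl K≢
    ...   | no w≢v   = λ C-w⊆C-v →
      contradiction refl (x∈p-y⇒x≢y (C-w⊆C-v (x∈p∧x≢y⇒x∈p-y v∈C (w≢v ∘ sym))))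

    module ChordStep {C C′ w} (cC : IsCircuit A C) (cC′ : IsCircuit A C′)
                     (w∈C′ : w ∈ C′) (w∉C : w ∉ C) (C′-w⊆C : C′ - w ⊆ C) where

      ⊕-outside-w : ∀ {y} → y ∈ C ⊕ C′ → y ≢ w → y ∈ C × y ∉ C′
      ⊕-outside-w {y} y∈ y≢w with x∈p⊕q⁻ C C′ y∈
      ... | inj₁ y∈C─C′        = y∈C─C′
      ... | inj₂ (y∉C , y∈C′) = contradiction (C′-w⊆C (x∈p∧x≢y⇒x∈p-y y∈C′ y≢w)) y∉C

      -- C′ shares at least two elements a, b with C, and neither lies in C ⊕ C′.
      ⊕-smaller : ∀ {D} → D ⊆ C ⊕ C′ → ∣ D ∣ < ∣ C ∣
      ⊕-smaller {D} D⊆C⊕C′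
        with 1<∣p∣⇒two-members (C′ - w) (≤-pred (≤-trans (3≤∣circuit∣ cC′) (∣p∣≤1+∣p-x∣ C′ w)))
      ... | a , b , a∈C′-w , b∈C′-w-a = begin-strict
        ∣ D ∣              ≤⟨ ∣p∣≤1+∣p-x∣ D w ⟩
        suc ∣ D - w ∣      ≤⟨ s≤s (p⊆q⇒∣p∣≤∣q∣ D-w⊆C-a-b) ⟩
        suc ∣ C - a - b ∣  ≤⟨ x∈p⇒∣p-x∣<∣p∣ b∈C-a ⟩
        ∣ C - a ∣          <⟨ x∈p⇒∣p-x∣<∣p∣ (C′-w⊆C a∈C′-w) ⟩
        ∣ C ∣              ∎
        where
        open ≤-Reasoning
        b∈C′-w = x∈p-y⇒x∈p b∈C′-w-a
        b∈C-a : b ∈ C - a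
        b∈C-a = x∈p∧x≢y⇒x∈p-y (C′-w⊆C b∈C′-w) (x∈p-y⇒x≢y b∈C′-w-a)
        D-w⊆C-a-b : D - w ⊆ C - a - b
        D-w⊆C-a-b {y} y∈D-w with ⊕-outside-w (D⊆C⊕C′ (x∈p-y⇒x∈p y∈D-w)) (x∈p-y⇒x≢y y∈D-w)
        ... | y∈C , y∉C′ = x∈p∧x≢y⇒x∈p-y
          (x∈p∧x≢y⇒x∈p-y y∈C λ { refl → y∉C′ (x∈p-y⇒x∈p a∈C′-w) })
          λ { refl → y∉C′ (x∈p-y⇒x∈p b∈C′-w) }

      module _ {T} (closed-below : ∀ D → ∣ D ∣ < ∣ C ∣ → IsCircuit A D →
                                   ∀ u → u ∈ D → D - u ⊆ T → u ∈ T) where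

        ⊕-forced : ∀ {x} → x ∈ C ⊕ C′ → (∀ {y} → y ∈ C ⊕ C′ → y ≢ x → y ∈ T) → x ∈ T
        ⊕-forced x∈ others
          with zeroSum⇒circuit-through (⊕-zeroSum (proj₂ (proj₁ cC)) (proj₂ (proj₁ cC′))) x∈
        ... | D , cD , D⊆C⊕C′ , x∈D = closed-below D (⊕-smaller D⊆C⊕C′) cD _ x∈D
          λ y∈D-x → others (D⊆C⊕C′ (x∈p-y⇒x∈p y∈D-x)) (x∈p-y⇒x≢y y∈D-x)

        closed-by-chord : ∣ C′ ∣ < ∣ C ∣ → ∀ {v} → v ∈ C → C - v ⊆ T → v ∈ T
        closed-by-chord C′<C {v} v∈C C-v⊆T with v ∈? C′
        ... | yes v∈C′ = closed-below C′ C′<C cC′ v v∈C′ (p-x⊆q⇒p⊆q C′-v-w⊆T w∈T)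
          where
          w∈T : w ∈ T
          w∈T = ⊕-forced (x∈p⊕q⁺ (inj₂ (w∉C , w∈C′))) λ y∈ y≢w →
            let y∈C , y∉C′ = ⊕-outside-w y∈ y≢w
            in C-v⊆T (x∈p∧x≢y⇒x∈p-y y∈C λ { refl → y∉C′ v∈C′ })
          C′-v-w⊆T : C′ - v - w ⊆ T
          C′-v-w⊆T y∈C′-v-w =
            let y∈C′-v = x∈p-y⇒x∈p y∈C′-v-w
                y∈C    = C′-w⊆C (x∈p∧x≢y⇒x∈p-y (x∈p-y⇒x∈p y∈C′-v) (x∈p-y⇒x≢y y∈C′-v-w))
            in C-v⊆T (x∈p∧x≢y⇒x∈p-y y∈C (x∈p-y⇒x≢y y∈C′-v))
        ... | no v∉C′  = ⊕-forced (x∈p⊕q⁺ (inj₁ (v∈C , v∉C′))) λ {y} y∈ y≢v → C-v-w⊆T y∈ y≢v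
          where
          w∈T : w ∈ T
          w∈T = closed-below C′ C′<C cC′ w w∈C′ λ y∈ →
            C-v⊆T (x∈p∧x≢y⇒x∈p-y (C′-w⊆C y∈) λ { refl → v∉C′ (x∈p-y⇒x∈p y∈) })
          C-v-w⊆T : ∀ {y} → y ∈ C ⊕ C′ → y ≢ v → y ∈ T
          C-v-w⊆T {y} y∈ y≢v with y ≟ᶠ w
          ... | yes refl = w∈T
          ... | no y≢w   = C-v⊆T (x∈p∧x≢y⇒x∈p-y (proj₁ (⊕-outside-w y∈ y≢w)) y≢v)

    Φ-chordless⇒closed : ∀ {T} → Φ (IsChordless A) T → ∀ C → Acc (_<_ on ∣_∣) C →
      IsCircuit A C → ∀ v → v ∈ C → C - v ⊆ T → v ∈ T
    Φ-chordless⇒closed φ C (acc smaller) cC v v∈C with HasChord? C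
    ... | no no-chord = Clause⇒implication (φ C (cC , no-chord) v v∈C)
    ... | yes (C′ , cC′ , ∣C′─C∣≡1 , C′<C) with ∣p─q∣≡1⇒single-outsider C′ C ∣C′─C∣≡1
    ...   | w , w∈C′ , w∉C , C′-w⊆C = ChordStep.closed-by-chord cC cC′ w∈C′ w∉C C′-w⊆C
            (λ D D<C → Φ-chordless⇒closed φ D (smaller D<C)) C′<C v∈C

    Φ-chordless⇒hM : ∀ {T} → Φ (IsChordless A) T → hM A T
    Φ-chordless⇒hM φ C cC v v∈C =
      implication⇒Clause (Φ-chordless⇒closed φ C (card-wellFounded C) cC v v∈C)

    Φ-chordless≐hM : Φ (IsChordless A) ≐ hM A
    Φ-chordless≐hM T = mk⇔ Φ-chordless⇒hM λ h X chordless → h X (proj₁ chordless)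

    hM-fails-at-C-v : ∀ {C v} → IsCircuit A C → v ∈ C → ¬ hM A (C - v)
    hM-fails-at-C-v cC v∈C h = Clause-fails-at-premise (h _ cC _ v∈C)

    chordless-clause-∈-representing : ∀ {Ks′ K} → All (IsCircuitClause A) Ks′ → Conj Ks′ ≐ hM A →
      IsChordlessClause K → K ∈ᴸ Ks′
    chordless-clause-∈-representing {Ks′} {_ , v} circuit-clauses Ks′≐hM (C , chordless , v∈C , refl) =
      decidable-stable ((C - v , v) ∈ᴷ? Ks′) λ K∉Ks′ →
        hM-fails-at-C-v (proj₁ chordless) v∈C (to (Ks′≐hM (C - v)) λ B w K′∈Ks′ →
          implication⇒Clause (chordless⇒C-v-closed-under-other-clauses chordless v∈C
            (All.lookup circuit-clauses K′∈Ks′) λ { refl → K∉Ks′ K′∈Ks′ }))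
      where open DecMembership _≟ᴷ_ using () renaming (_∈?_ to _∈ᴷ?_)

    chordless-circuit-∈-representing : ∀ {Ds′ X} → All (IsCircuit A) Ds′ → Φ (FamOf Ds′) ≐ hM A →
      IsChordless A X → X ∈ᴸ Ds′
    chordless-circuit-∈-representing {Ds′} {X} circuits Ds′≐hM chordless@(cX , _) with proj₁ (proj₁ cX)
    ... | v , v∈X = decidable-stable (X ∈ˢ? Ds′) λ X∉Ds′ →
      hM-fails-at-C-v cX v∈X (to (Ds′≐hM (X - v)) λ Y Y∈Ds′ w w∈Y →
        implication⇒Clause (chordless⇒C-v-closed-under-other-clauses chordless v∈X
          (Y , All.lookup circuits Y∈Ds′ , w∈Y , refl)
          λ eq → X∉Ds′ (subst (_∈ᴸ Ds′) ([p-x,x]≡[q-y,y]⇒p≡q w∈Y v∈X eq) Y∈Ds′)))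
      where open DecMembership _≟ˢ_ using () renaming (_∈?_ to _∈ˢ?_)

theorem17 : ∀ {m n} (A : Matrix m n) → Simple A →
    (Ds : List (Subset n)) → Unique Ds → (∀ X → X ∈ᴸ Ds ⇔ IsChordless A X) →
    (Ks : List (ClauseSyn n)) → Unique Ks →
    (∀ B v → (B , v) ∈ᴸ Ks ⇔ Σ (Subset n) (λ C → IsChordless A C × v ∈ C × B ≡ C - v)) →
    ((Φ (FamOf Ds) ≐ hM A)
      × (∀ (Ds' : List (Subset n)) → Unique Ds' → All (IsCircuit A) Ds' →
           Φ (FamOf Ds') ≐ hM A →
           (length Ds ≤ length Ds')
           × (length Ds' ≡ length Ds → ∀ X → X ∈ᴸ Ds' ⇔ X ∈ᴸ Ds)))
    × ((Conj Ks ≐ hM A)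
      × (∀ (Ks' : List (ClauseSyn n)) → Unique Ks' → All (IsCircuitClause A) Ks' →
           Conj Ks' ≐ hM A →
           (length Ks ≤ length Ks')
           × (length Ks' ≡ length Ks → ∀ K → K ∈ᴸ Ks' ⇔ K ∈ᴸ Ks)))
theorem17 A simple Ds Unique[Ds] Ds⇔chordless Ks Unique[Ks] Ks⇔chordless =
  ( ≐-trans (Φ-cong Ds⇔chordless) (Φ-chordless≐hM A simple)
  , λ Ds′ _ circuits Ds′≐hM → Unique∧⊆⇒minimal _≟ˢ_ Unique[Ds] λ X∈Ds →
      chordless-circuit-∈-representing A simple circuits Ds′≐hM (to (Ds⇔chordless _) X∈Ds) )
  , ( ≐-trans (Conj≐Φ Ks⇔chordless) (Φ-chordless≐hM A simple)
    , λ Ks′ _ circuit-clauses Ks′≐hM → Unique∧⊆⇒minimal _≟ᴷ_ Unique[Ks] λ { {B , v} K∈Ks →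
        chordless-clause-∈-representing A simple circuit-clauses Ks′≐hM (to (Ks⇔chordless B v) K∈Ks) } )
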